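{- Let $g$ be a closed term with $\vdash g:\mathsf{N}\to\mathsf{N}_2$ in $\mathrm{MLTT}$ which is compatible with a condition $p$. If $\Gamma\vdash_p J$ holds in the forcing extension, then $\Gamma[g/\mathsf{f}, v_g/\mathsf{w}]\vdash J[g/\mathsf{f},v_g/\mathsf{w}]$ is a valid judgment of $\mathrm{MLTT}$ (i.e. replacing $\mathsf{f}$ by $g$ and then $\mathsf{w}$ by $v_g$ yields a derivable judgment). In particular, if $\Gamma\vdash_\emptyset J$ where neither $\mathsf{f}$ nor $\mathsf{w}$ occurs in $\Gamma$ or $J$, then $\Gamma\vdash J$ is derivable in $\mathrm{MLTT}$.
   Context: $\mathrm{MLTT}$ is Martin-Löf type theory with $\Pi$ (with $\beta$, $\eta$/function extensionality), $\Sigma$ (with surjective pairing), $\mathsf{N}_0,\mathsf{N}_1,\mathsf{N}_2,\mathsf{N}$ with their dependent recursors $\mathsf{rec}_{\mathsf{N}_0},\mathsf{rec}_{\mathsf{N}_1},\mathsf{rec}_{\mathsf{N}_2},\mathsf{rec}_\mathsf{N}$, and one universe $\mathsf{U}$ à la Russell, with conversion as a judgment. Write $\overline{n}:=\mathsf{S}^n\,\mathsf{0}$, $\neg A := A\to\mathsf{N}_0$, $\mathsf{IsZero}:=\lambda y.\mathsf{rec}_{\mathsf{N}_2}(\lambda x.\mathsf{U})\,\mathsf{N}_1\,\mathsf{N}_0\,y$. A condition $p$ is (the graph of) a finite partial function $\mathbb{N}\to\{\mathsf{0},\mathsf{1}\}$; $q\leqslant p$ means $p\subseteq q$; $\emptyset$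 is the empty condition; for $n\notin\mathrm{dom}(p)$, $p(n\mapsto b):=p\cup\{(n,b)\}$. Partitions $p\vartriangleleft S$ are defined inductively: $p\vartriangleleft\{p\}$; and if $n\notin\mathrm{dom}(p)$, $p(n\mapsto\mathsf{0})\vartriangleleft S_0$, $p(n\mapsto\mathsf{1})\vartriangleleft S_1$, then $p\vartriangleleft S_0\cup S_1$. The forcing extension has judgments $\Gamma\vdash_p J$ annotated by conditions: every rule of $\mathrm{MLTT}$ is included with all its premises and conclusion annotated by the same $p$; plus the locality rule (from $\Gamma\vdash_{p_i}J$ for all $i$ and $p\vartriangleleft\{p_1,\dots,p_n\}$ infer $\Gamma\vdash_p J$); a constant $\mathsf{f}$ with rules: from $\Gamma\vdash_p$ infer $\Gamma\vdash_p\mathsf{f}:\mathsf{N}\to\mathsf{N}_2$, and from $\Gamma\vdash_p$ infer $\Gamma\vdash_p \mathsf{f}\,\overline{n}=p(n):\mathsf{N}_2$ for $n\in\mathrm{dom}(p)$; and a constant $\mathsf{w}$ with rule: from $\Gamma\vdash_p$ infer $\Gamma\vdash_p\mathsf{w}:\neg\neg(\Sigma(x:\mathsf{N})\,\mathsf{IsZero}\,(\mathsf{f}\,x))$. A closed $g$ with $\vdash g:\mathsf{N}\to\mathsf{N}_2$ is compatible with $p$ if $\vdash g\,\overline{n}=b:\mathsf{N}_2$ whenever $(n,b)\in p$ and $\vdash g\,\overline{n}=\mathsf{0}:\mathsf{N}_2$ whenever $n\notin\mathrm{dom}(p)$. Then $n_g$ denotes the smallest natural number with $\vdash g\,\overline{n_g}=\mathsf{0}:\mathsf{N}_2$,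 and $v_g:=\lambda x.\,x\,(\overline{n_g},\mathsf{0})$, a term of type $\neg\neg(\Sigma(y:\mathsf{N})\,\mathsf{IsZero}\,(g\,y))$. -}

module Defs where

open import Data.Nat using (ℕ; zero; suc; _<_)
open import Data.Fin using (Fin) renaming (zero to fz; suc to fs)
open import Data.Bool using (Bool; true; false)
open import Data.List using (List; []; _∷_; _++_)
open import Data.List.Membership.Propositional using (_∈_)
open import Data.List.Relation.Unary.Any using (Any)
open import Data.List.Relation.Unary.All using (All)
open import Data.List.Relation.Unary.All.Properties using (¬Any⇒All¬)
open import Data.List.Relation.Unary.AllPairs using (AllPairs; []; _∷_)
open import Data.Product using (_×_; _,_; proj₁)
open import Data.Unit using (⊤)
open import Data.Empty using (⊥)
open import Relation.Nullary using (¬_)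
open import Relation.Binary.PropositionalEquality using (_≡_; _≢_)

-- Binders: Π A B, Σ A B, lam t bind one variable in B / t;
-- the motives C of the recursors bind one variable; the step of recN
-- binds two (x : N, then ih : C x).

data Tm (n : ℕ) : Set where
  var   : Fin n → Tm n
  U     : Tm n
  Π Σ   : Tm n → Tm (suc n) → Tm n
  lam   : Tm (suc n) → Tm n
  app   : Tm n → Tm n → Tm n
  pair  : Tm n → Tm n → Tm n
  fst snd : Tm n → Tm n
  N₀ N₁ N₂ N : Tm n
  rec₀  : Tm (suc n) → Tm n → Tm n
  ⋆     : Tm n
  rec₁  : Tm (suc n) → Tm n → Tm n → Tm n
  zero₂ one₂ : Tm n
  rec₂  : Tm (suc n) → Tm n → Tm n → Tm n → Tm n
  zeroN : Tm n
  sucN  : Tm n → Tm n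
  recN  : Tm (suc n) → Tm n → Tm (suc (suc n)) → Tm n → Tm n
  cf cw : Tm n

liftr : ∀ {m n} → (Fin m → Fin n) → Fin (suc m) → Fin (suc n)
liftr ρ fz = fz
liftr ρ (fs i) = fs (ρ i)

ren : ∀ {m n} → (Fin m → Fin n) → Tm m → Tm n
ren ρ (var x) = var (ρ x)
ren ρ U = U
ren ρ (Π A B) = Π (ren ρ A) (ren (liftr ρ) B)
ren ρ (Σ A B) = Σ (ren ρ A) (ren (liftr ρ) B)
ren ρ (lam t) = lam (ren (liftr ρ) t)
ren ρ (app t u) = app (ren ρ t) (ren ρ u)
ren ρ (pair t u) = pair (ren ρ t) (ren ρ u)
ren ρ (fst t) = fst (ren ρ t)
ren ρ (snd t) = snd (ren ρ t)
ren ρ N₀ = N₀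
ren ρ N₁ = N₁
ren ρ N₂ = N₂
ren ρ N = N
ren ρ (rec₀ C t) = rec₀ (ren (liftr ρ) C) (ren ρ t)
ren ρ ⋆ = ⋆
ren ρ (rec₁ C c t) = rec₁ (ren (liftr ρ) C) (ren ρ c) (ren ρ t)
ren ρ zero₂ = zero₂
ren ρ one₂ = one₂
ren ρ (rec₂ C a b t) = rec₂ (ren (liftr ρ) C) (ren ρ a) (ren ρ b) (ren ρ t)
ren ρ zeroN = zeroN
ren ρ (sucN t) = sucN (ren ρ t)
ren ρ (recN C z s t) = recN (ren (liftr ρ) C) (ren ρ z) (ren (liftr (liftr ρ)) s) (ren ρ t)
ren ρ cf = cf
ren ρ cw = cw

wk : ∀ {n} → Tm n → Tm (suc n)
wk = ren fs

lifts : ∀ {m n} → (Fin m → Tm n) → Fin (suc m) → Tm (suc n)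
lifts σ fz = var fz
lifts σ (fs i) = wk (σ i)

sub : ∀ {m n} → (Fin m → Tm n) → Tm m → Tm n
sub σ (var x) = σ x
sub σ U = U
sub σ (Π A B) = Π (sub σ A) (sub (lifts σ) B)
sub σ (Σ A B) = Σ (sub σ A) (sub (lifts σ) B)
sub σ (lam t) = lam (sub (lifts σ) t)
sub σ (app t u) = app (sub σ t) (sub σ u)
sub σ (pair t u) = pair (sub σ t) (sub σ u)
sub σ (fst t) = fst (sub σ t)
sub σ (snd t) = snd (sub σ t)
sub σ N₀ = N₀
sub σ N₁ = N₁
sub σ N₂ = N₂
sub σ N = N
sub σ (rec₀ C t) = rec₀ (sub (lifts σ) C) (sub σ t)
sub σ ⋆ = ⋆
sub σ (rec₁ C c t) = rec₁ (sub (lifts σ) C) (sub σ c) (sub σ t)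
sub σ zero₂ = zero₂
sub σ one₂ = one₂
sub σ (rec₂ C a b t) = rec₂ (sub (lifts σ) C) (sub σ a) (sub σ b) (sub σ t)
sub σ zeroN = zeroN
sub σ (sucN t) = sucN (sub σ t)
sub σ (recN C z s t) = recN (sub (lifts σ) C) (sub σ z) (sub (lifts (lifts σ)) s) (sub σ t)
sub σ cf = cf
sub σ cw = cw

_[_]₀ : ∀ {n} → Tm (suc n) → Tm n → Tm n
B [ u ]₀ = sub σ B
  where σ : Fin (suc _) → Tm _
        σ fz = u
        σ (fs i) = var i

-- s[x := n, ih := r] for the step of recN (ih is variable 0, x variable 1)
_[_,_]₁ : ∀ {n} → Tm (suc (suc n)) → Tm n → Tm n → Tm n
s [ n , r ]₁ = sub σ s
  where σ : Fin (suc (suc _)) → Tm _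
        σ fz = r
        σ (fs fz) = n
        σ (fs (fs i)) = var i

stepTy : ∀ {n} → Tm (suc n) → Tm (suc (suc n))
stepTy C = sub σ C
  where σ : Fin (suc _) → Tm (suc (suc _))
        σ fz = sucN (var (fs fz))
        σ (fs i) = var (fs (fs i))

close : ∀ {n} → Tm 0 → Tm n
close = ren (λ ())

num : ∀ {n} → ℕ → Tm n
num zero = zeroN
num (suc k) = sucN (num k)

¬ᵗ : ∀ {n} → Tm n → Tm n
¬ᵗ A = Π A N₀

IsZero : ∀ {n} → Tm n → Tm n
IsZero y = rec₂ U N₁ N₀ y

wTy : ∀ {n} → Tm n → Tm n
wTy h = ¬ᵗ (¬ᵗ (Σ N (IsZero (app (wk h) (var fz)))))

bit : ∀ {n} → Bool → Tm n
bit false = zero₂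
bit true = one₂

data Con : ℕ → Set where
  ε   : Con 0
  _∙_ : ∀ {n} → Con n → Tm n → Con (suc n)

data _⦂_∈ᶜ_ : ∀ {n} → Fin n → Tm n → Con n → Set where
  here  : ∀ {n} {Γ : Con n} {A} → fz ⦂ wk A ∈ᶜ (Γ ∙ A)
  there : ∀ {n} {Γ : Con n} {x A B} → x ⦂ A ∈ᶜ Γ → fs x ⦂ wk A ∈ᶜ (Γ ∙ B)

data Jdg (n : ℕ) : Set where
  ctx  : Jdg n
  ty   : Tm n → Jdg n
  tyEq : Tm n → Tm n → Jdg n
  tm   : Tm n → Tm n → Jdg n
  tmEq : Tm n → Tm n → Tm n → Jdg n

-- Conditions: graphs of finite partial functions ℕ → {0,1}
-- (false ↦ 0, true ↦ 1); functionality is enforced.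

record Cond : Set where
  constructor mkCond
  field
    graph      : List (ℕ × Bool)
    functional : AllPairs (λ a b → proj₁ a ≢ proj₁ b) graph
open Cond public

∅ : Cond
∅ = mkCond [] []

_∈dom_ : ℕ → Cond → Set
n ∈dom p = Any (λ e → n ≡ proj₁ e) (graph p)

extend : (p : Cond) (n : ℕ) → ¬ (n ∈dom p) → Bool → Cond
extend p n n∉ b = mkCond ((n , b) ∷ graph p) (¬Any⇒All¬ (graph p) n∉ ∷ functional p)

data _◁_ (p : Cond) : List Cond → Set where
  ◁refl  : p ◁ (p ∷ [])
  ◁split : ∀ {S₀ S₁} (n : ℕ) (n∉ : ¬ (n ∈dom p)) →
           extend p n n∉ false ◁ S₀ → extend p n n∉ true ◁ S₁ → p ◁ (S₀ ++ S₁)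

-- Mode `mltt` is plain MLTT; mode `forc p` is the forcing
-- extension at condition p.  Every MLTT rule is given uniformly in the mode
-- (premises and conclusion annotated by the same mode); locality and the
-- rules for f, w exist only in forcing modes.

data Mode : Set where
  mltt : Mode
  forc : Cond → Mode

infix 4 _⊢[_]_

data _⊢[_]_ : ∀ {n} → Con n → Mode → Jdg n → Set where
  ε-wf  : ∀ {m} → ε ⊢[ m ] ctx
  ∙-wf  : ∀ {m n} {Γ : Con n} {A} → Γ ⊢[ m ] ty A → (Γ ∙ A) ⊢[ m ] ctx
  U-ty  : ∀ {m n} {Γ : Con n} → Γ ⊢[ m ] ctx → Γ ⊢[ m ] ty U
  univ  : ∀ {m n} {Γ : Con n} {A} → Γ ⊢[ m ] tm A U → Γ ⊢[ m ] ty A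
  Π-ty  : ∀ {m n} {Γ : Con n} {A B} → Γ ⊢[ m ] ty A → (Γ ∙ A) ⊢[ m ] ty B → Γ ⊢[ m ] ty (Π A B)
  Σ-ty  : ∀ {m n} {Γ : Con n} {A B} → Γ ⊢[ m ] ty A → (Γ ∙ A) ⊢[ m ] ty B → Γ ⊢[ m ] ty (Σ A B)
  ty-refl  : ∀ {m n} {Γ : Con n} {A} → Γ ⊢[ m ] ty A → Γ ⊢[ m ] tyEq A A
  ty-sym   : ∀ {m n} {Γ : Con n} {A B} → Γ ⊢[ m ] tyEq A B → Γ ⊢[ m ] tyEq B A
  ty-trans : ∀ {m n} {Γ : Con n} {A B C} → Γ ⊢[ m ] tyEq A B → Γ ⊢[ m ] tyEq B C → Γ ⊢[ m ] tyEq A C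
  univ-eq  : ∀ {m n} {Γ : Con n} {A B} → Γ ⊢[ m ] tmEq A B U → Γ ⊢[ m ] tyEq A B
  Π-cong   : ∀ {m n} {Γ : Con n} {A A' B B'} → Γ ⊢[ m ] ty A → Γ ⊢[ m ] tyEq A A' →
             (Γ ∙ A) ⊢[ m ] tyEq B B' → Γ ⊢[ m ] tyEq (Π A B) (Π A' B')
  Σ-cong   : ∀ {m n} {Γ : Con n} {A A' B B'} → Γ ⊢[ m ] ty A → Γ ⊢[ m ] tyEq A A' →
             (Γ ∙ A) ⊢[ m ] tyEq B B' → Γ ⊢[ m ] tyEq (Σ A B) (Σ A' B')
  Π-U   : ∀ {m n} {Γ : Con n} {A B} → Γ ⊢[ m ] tm A U → (Γ ∙ A) ⊢[ m ] tm B U → Γ ⊢[ m ] tm (Π A B) U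
  Σ-U   : ∀ {m n} {Γ : Con n} {A B} → Γ ⊢[ m ] tm A U → (Γ ∙ A) ⊢[ m ] tm B U → Γ ⊢[ m ] tm (Σ A B) U
  N₀-U  : ∀ {m n} {Γ : Con n} → Γ ⊢[ m ] ctx → Γ ⊢[ m ] tm N₀ U
  N₁-U  : ∀ {m n} {Γ : Con n} → Γ ⊢[ m ] ctx → Γ ⊢[ m ] tm N₁ U
  N₂-U  : ∀ {m n} {Γ : Con n} → Γ ⊢[ m ] ctx → Γ ⊢[ m ] tm N₂ U
  N-U   : ∀ {m n} {Γ : Con n} → Γ ⊢[ m ] ctx → Γ ⊢[ m ] tm N U
  var-tm : ∀ {m n} {Γ : Con n} {x A} → Γ ⊢[ m ] ctx → x ⦂ A ∈ᶜ Γ → Γ ⊢[ m ] tm (var x) A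
  conv   : ∀ {m n} {Γ : Con n} {t A B} → Γ ⊢[ m ] tm t A → Γ ⊢[ m ] tyEq A B → Γ ⊢[ m ] tm t B
  lam-tm : ∀ {m n} {Γ : Con n} {A B t} → Γ ⊢[ m ] ty A → (Γ ∙ A) ⊢[ m ] tm t B → Γ ⊢[ m ] tm (lam t) (Π A B)
  app-tm : ∀ {m n} {Γ : Con n} {A B t u} → Γ ⊢[ m ] tm t (Π A B) → Γ ⊢[ m ] tm u A →
           Γ ⊢[ m ] tm (app t u) (B [ u ]₀)
  pair-tm : ∀ {m n} {Γ : Con n} {A B t u} → Γ ⊢[ m ] ty A → (Γ ∙ A) ⊢[ m ] ty B →
            Γ ⊢[ m ] tm t A → Γ ⊢[ m ] tm u (B [ t ]₀) → Γ ⊢[ m ] tm (pair t u) (Σ A B)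
  fst-tm : ∀ {m n} {Γ : Con n} {A B t} → Γ ⊢[ m ] tm t (Σ A B) → Γ ⊢[ m ] tm (fst t) A
  snd-tm : ∀ {m n} {Γ : Con n} {A B t} → Γ ⊢[ m ] tm t (Σ A B) → Γ ⊢[ m ] tm (snd t) (B [ fst t ]₀)
  rec₀-tm : ∀ {m n} {Γ : Con n} {C t} → (Γ ∙ N₀) ⊢[ m ] ty C → Γ ⊢[ m ] tm t N₀ →
            Γ ⊢[ m ] tm (rec₀ C t) (C [ t ]₀)
  ⋆-tm   : ∀ {m n} {Γ : Con n} → Γ ⊢[ m ] ctx → Γ ⊢[ m ] tm ⋆ N₁
  rec₁-tm : ∀ {m n} {Γ : Con n} {C c t} → (Γ ∙ N₁) ⊢[ m ] ty C → Γ ⊢[ m ] tm c (C [ ⋆ ]₀) →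
            Γ ⊢[ m ] tm t N₁ → Γ ⊢[ m ] tm (rec₁ C c t) (C [ t ]₀)
  zero₂-tm : ∀ {m n} {Γ : Con n} → Γ ⊢[ m ] ctx → Γ ⊢[ m ] tm zero₂ N₂
  one₂-tm  : ∀ {m n} {Γ : Con n} → Γ ⊢[ m ] ctx → Γ ⊢[ m ] tm one₂ N₂
  rec₂-tm : ∀ {m n} {Γ : Con n} {C a b t} → (Γ ∙ N₂) ⊢[ m ] ty C → Γ ⊢[ m ] tm a (C [ zero₂ ]₀) →
            Γ ⊢[ m ] tm b (C [ one₂ ]₀) → Γ ⊢[ m ] tm t N₂ → Γ ⊢[ m ] tm (rec₂ C a b t) (C [ t ]₀)
  zeroN-tm : ∀ {m n} {Γ : Con n} → Γ ⊢[ m ] ctx → Γ ⊢[ m ] tm zeroN N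
  sucN-tm  : ∀ {m n} {Γ : Con n} {t} → Γ ⊢[ m ] tm t N → Γ ⊢[ m ] tm (sucN t) N
  recN-tm : ∀ {m n} {Γ : Con n} {C z s t} → (Γ ∙ N) ⊢[ m ] ty C → Γ ⊢[ m ] tm z (C [ zeroN ]₀) →
            ((Γ ∙ N) ∙ C) ⊢[ m ] tm s (stepTy C) → Γ ⊢[ m ] tm t N →
            Γ ⊢[ m ] tm (recN C z s t) (C [ t ]₀)
  tm-refl  : ∀ {m n} {Γ : Con n} {t A} → Γ ⊢[ m ] tm t A → Γ ⊢[ m ] tmEq t t A
  tm-sym   : ∀ {m n} {Γ : Con n} {t u A} → Γ ⊢[ m ] tmEq t u A → Γ ⊢[ m ] tmEq u t A
  tm-trans : ∀ {m n} {Γ : Con n} {t u v A} → Γ ⊢[ m ] tmEq t u A → Γ ⊢[ m ] tmEq u v A → Γ ⊢[ m ] tmEq t v A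
  conv-eq  : ∀ {m n} {Γ : Con n} {t u A B} → Γ ⊢[ m ] tmEq t u A → Γ ⊢[ m ] tyEq A B → Γ ⊢[ m ] tmEq t u B
  Π-cong-U : ∀ {m n} {Γ : Con n} {A A' B B'} → Γ ⊢[ m ] tm A U → Γ ⊢[ m ] tmEq A A' U →
             (Γ ∙ A) ⊢[ m ] tmEq B B' U → Γ ⊢[ m ] tmEq (Π A B) (Π A' B') U
  Σ-cong-U : ∀ {m n} {Γ : Con n} {A A' B B'} → Γ ⊢[ m ] tm A U → Γ ⊢[ m ] tmEq A A' U →
             (Γ ∙ A) ⊢[ m ] tmEq B B' U → Γ ⊢[ m ] tmEq (Σ A B) (Σ A' B') U
  lam-cong : ∀ {m n} {Γ : Con n} {A B t t'} → Γ ⊢[ m ] ty A → (Γ ∙ A) ⊢[ m ] tmEq t t' B →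
             Γ ⊢[ m ] tmEq (lam t) (lam t') (Π A B)
  app-cong : ∀ {m n} {Γ : Con n} {A B t t' u u'} → Γ ⊢[ m ] tmEq t t' (Π A B) → Γ ⊢[ m ] tmEq u u' A →
             Γ ⊢[ m ] tmEq (app t u) (app t' u') (B [ u ]₀)
  pair-cong : ∀ {m n} {Γ : Con n} {A B t t' u u'} → Γ ⊢[ m ] ty A → (Γ ∙ A) ⊢[ m ] ty B →
              Γ ⊢[ m ] tmEq t t' A → Γ ⊢[ m ] tmEq u u' (B [ t ]₀) →
              Γ ⊢[ m ] tmEq (pair t u) (pair t' u') (Σ A B)
  fst-cong : ∀ {m n} {Γ : Con n} {A B t t'} → Γ ⊢[ m ] tmEq t t' (Σ A B) → Γ ⊢[ m ] tmEq (fst t) (fst t') A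
  snd-cong : ∀ {m n} {Γ : Con n} {A B t t'} → Γ ⊢[ m ] tmEq t t' (Σ A B) →
             Γ ⊢[ m ] tmEq (snd t) (snd t') (B [ fst t ]₀)
  rec₀-cong : ∀ {m n} {Γ : Con n} {C C' t t'} → (Γ ∙ N₀) ⊢[ m ] tyEq C C' → Γ ⊢[ m ] tmEq t t' N₀ →
              Γ ⊢[ m ] tmEq (rec₀ C t) (rec₀ C' t') (C [ t ]₀)
  rec₁-cong : ∀ {m n} {Γ : Con n} {C C' c c' t t'} → (Γ ∙ N₁) ⊢[ m ] tyEq C C' →
              Γ ⊢[ m ] tmEq c c' (C [ ⋆ ]₀) → Γ ⊢[ m ] tmEq t t' N₁ →
              Γ ⊢[ m ] tmEq (rec₁ C c t) (rec₁ C' c' t') (C [ t ]₀)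
  rec₂-cong : ∀ {m n} {Γ : Con n} {C C' a a' b b' t t'} → (Γ ∙ N₂) ⊢[ m ] tyEq C C' →
              Γ ⊢[ m ] tmEq a a' (C [ zero₂ ]₀) → Γ ⊢[ m ] tmEq b b' (C [ one₂ ]₀) →
              Γ ⊢[ m ] tmEq t t' N₂ → Γ ⊢[ m ] tmEq (rec₂ C a b t) (rec₂ C' a' b' t') (C [ t ]₀)
  sucN-cong : ∀ {m n} {Γ : Con n} {t t'} → Γ ⊢[ m ] tmEq t t' N → Γ ⊢[ m ] tmEq (sucN t) (sucN t') N
  recN-cong : ∀ {m n} {Γ : Con n} {C C' z z' s s' t t'} → (Γ ∙ N) ⊢[ m ] tyEq C C' →
              Γ ⊢[ m ] tmEq z z' (C [ zeroN ]₀) → ((Γ ∙ N) ∙ C) ⊢[ m ] tmEq s s' (stepTy C) →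
              Γ ⊢[ m ] tmEq t t' N → Γ ⊢[ m ] tmEq (recN C z s t) (recN C' z' s' t') (C [ t ]₀)
  -- Π: β and η (function extensionality form)
  Π-β : ∀ {m n} {Γ : Con n} {A B t u} → Γ ⊢[ m ] ty A → (Γ ∙ A) ⊢[ m ] tm t B → Γ ⊢[ m ] tm u A →
        Γ ⊢[ m ] tmEq (app (lam t) u) (t [ u ]₀) (B [ u ]₀)
  Π-η : ∀ {m n} {Γ : Con n} {A B t t'} → Γ ⊢[ m ] ty A → Γ ⊢[ m ] tm t (Π A B) → Γ ⊢[ m ] tm t' (Π A B) →
        (Γ ∙ A) ⊢[ m ] tmEq (app (wk t) (var fz)) (app (wk t') (var fz)) B →
        Γ ⊢[ m ] tmEq t t' (Π A B)
  Σ-β₁ : ∀ {m n} {Γ : Con n} {A B t u} → Γ ⊢[ m ] ty A → (Γ ∙ A) ⊢[ m ] ty B →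
         Γ ⊢[ m ] tm t A → Γ ⊢[ m ] tm u (B [ t ]₀) → Γ ⊢[ m ] tmEq (fst (pair t u)) t A
  Σ-β₂ : ∀ {m n} {Γ : Con n} {A B t u} → Γ ⊢[ m ] ty A → (Γ ∙ A) ⊢[ m ] ty B →
         Γ ⊢[ m ] tm t A → Γ ⊢[ m ] tm u (B [ t ]₀) → Γ ⊢[ m ] tmEq (snd (pair t u)) u (B [ t ]₀)
  Σ-η  : ∀ {m n} {Γ : Con n} {A B t t'} → Γ ⊢[ m ] tm t (Σ A B) → Γ ⊢[ m ] tm t' (Σ A B) →
         Γ ⊢[ m ] tmEq (fst t) (fst t') A → Γ ⊢[ m ] tmEq (snd t) (snd t') (B [ fst t ]₀) →
         Γ ⊢[ m ] tmEq t t' (Σ A B)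
  rec₁-β : ∀ {m n} {Γ : Con n} {C c} → (Γ ∙ N₁) ⊢[ m ] ty C → Γ ⊢[ m ] tm c (C [ ⋆ ]₀) →
           Γ ⊢[ m ] tmEq (rec₁ C c ⋆) c (C [ ⋆ ]₀)
  rec₂-β₀ : ∀ {m n} {Γ : Con n} {C a b} → (Γ ∙ N₂) ⊢[ m ] ty C → Γ ⊢[ m ] tm a (C [ zero₂ ]₀) →
            Γ ⊢[ m ] tm b (C [ one₂ ]₀) → Γ ⊢[ m ] tmEq (rec₂ C a b zero₂) a (C [ zero₂ ]₀)
  rec₂-β₁ : ∀ {m n} {Γ : Con n} {C a b} → (Γ ∙ N₂) ⊢[ m ] ty C → Γ ⊢[ m ] tm a (C [ zero₂ ]₀) →
            Γ ⊢[ m ] tm b (C [ one₂ ]₀) → Γ ⊢[ m ] tmEq (rec₂ C a b one₂) b (C [ one₂ ]₀)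
  recN-β₀ : ∀ {m n} {Γ : Con n} {C z s} → (Γ ∙ N) ⊢[ m ] ty C → Γ ⊢[ m ] tm z (C [ zeroN ]₀) →
            ((Γ ∙ N) ∙ C) ⊢[ m ] tm s (stepTy C) →
            Γ ⊢[ m ] tmEq (recN C z s zeroN) z (C [ zeroN ]₀)
  recN-βS : ∀ {m n} {Γ : Con n} {C z s t} → (Γ ∙ N) ⊢[ m ] ty C → Γ ⊢[ m ] tm z (C [ zeroN ]₀) →
            ((Γ ∙ N) ∙ C) ⊢[ m ] tm s (stepTy C) → Γ ⊢[ m ] tm t N →
            Γ ⊢[ m ] tmEq (recN C z s (sucN t)) (s [ t , recN C z s t ]₁) (C [ sucN t ]₀)
  locality : ∀ {n} {Γ : Con n} {J} {p : Cond} {S : List Cond} →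
             (∀ q → q ∈ S → Γ ⊢[ forc q ] J) → p ◁ S → Γ ⊢[ forc p ] J
  f-tm  : ∀ {n} {Γ : Con n} {p} → Γ ⊢[ forc p ] ctx → Γ ⊢[ forc p ] tm cf (Π N N₂)
  f-val : ∀ {n} {Γ : Con n} {p} {k b} → Γ ⊢[ forc p ] ctx → (k , b) ∈ graph p →
          Γ ⊢[ forc p ] tmEq (app cf (num k)) (bit b) N₂
  w-tm  : ∀ {n} {Γ : Con n} {p} → Γ ⊢[ forc p ] ctx → Γ ⊢[ forc p ] tm cw (wTy cf)

repl : ∀ {n} → Tm 0 → Tm 0 → Tm n → Tm n
repl g v (var x) = var x
repl g v U = U
repl g v (Π A B) = Π (repl g v A) (repl g v B)
repl g v (Σ A B) = Σ (repl g v A) (repl g v B)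
repl g v (lam t) = lam (repl g v t)
repl g v (app t u) = app (repl g v t) (repl g v u)
repl g v (pair t u) = pair (repl g v t) (repl g v u)
repl g v (fst t) = fst (repl g v t)
repl g v (snd t) = snd (repl g v t)
repl g v N₀ = N₀
repl g v N₁ = N₁
repl g v N₂ = N₂
repl g v N = N
repl g v (rec₀ C t) = rec₀ (repl g v C) (repl g v t)
repl g v ⋆ = ⋆
repl g v (rec₁ C c t) = rec₁ (repl g v C) (repl g v c) (repl g v t)
repl g v zero₂ = zero₂
repl g v one₂ = one₂
repl g v (rec₂ C a b t) = rec₂ (repl g v C) (repl g v a) (repl g v b) (repl g v t)
repl g v zeroN = zeroN
repl g v (sucN t) = sucN (repl g v t)
repl g v (recN C z s t) = recN (repl g v C) (repl g v z) (repl g v s) (repl g v t)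
repl g v cf = close g
repl g v cw = close v

replCon : ∀ {n} → Tm 0 → Tm 0 → Con n → Con n
replCon g v ε = ε
replCon g v (Γ ∙ A) = replCon g v Γ ∙ repl g v A

replJ : ∀ {n} → Tm 0 → Tm 0 → Jdg n → Jdg n
replJ g v ctx = ctx
replJ g v (ty A) = ty (repl g v A)
replJ g v (tyEq A B) = tyEq (repl g v A) (repl g v B)
replJ g v (tm t A) = tm (repl g v t) (repl g v A)
replJ g v (tmEq t u A) = tmEq (repl g v t) (repl g v u) (repl g v A)

ConstFree : ∀ {n} → Tm n → Set
ConstFree (var x) = ⊤
ConstFree U = ⊤
ConstFree (Π A B) = ConstFree A × ConstFree B
ConstFree (Σ A B) = ConstFree A × ConstFree B
ConstFree (lam t) = ConstFree t
ConstFree (app t u) = ConstFree t × ConstFree u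
ConstFree (pair t u) = ConstFree t × ConstFree u
ConstFree (fst t) = ConstFree t
ConstFree (snd t) = ConstFree t
ConstFree N₀ = ⊤
ConstFree N₁ = ⊤
ConstFree N₂ = ⊤
ConstFree N = ⊤
ConstFree (rec₀ C t) = ConstFree C × ConstFree t
ConstFree ⋆ = ⊤
ConstFree (rec₁ C c t) = ConstFree C × ConstFree c × ConstFree t
ConstFree zero₂ = ⊤
ConstFree one₂ = ⊤
ConstFree (rec₂ C a b t) = ConstFree C × ConstFree a × ConstFree b × ConstFree t
ConstFree zeroN = ⊤
ConstFree (sucN t) = ConstFree t
ConstFree (recN C z s t) = ConstFree C × ConstFree z × ConstFree s × ConstFree t
ConstFree cf = ⊥
ConstFree cw = ⊥

ConstFreeCon : ∀ {n} → Con n → Set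
ConstFreeCon ε = ⊤
ConstFreeCon (Γ ∙ A) = ConstFreeCon Γ × ConstFree A

ConstFreeJ : ∀ {n} → Jdg n → Set
ConstFreeJ ctx = ⊤
ConstFreeJ (ty A) = ConstFree A
ConstFreeJ (tyEq A B) = ConstFree A × ConstFree B
ConstFreeJ (tm t A) = ConstFree t × ConstFree A
ConstFreeJ (tmEq t u A) = ConstFree t × ConstFree u × ConstFree A

Compatible : Tm 0 → Cond → Set
Compatible g p =
  (∀ k b → (k , b) ∈ graph p → ε ⊢[ mltt ] tmEq (app g (num k)) (bit b) N₂) ×
  (∀ k → ¬ (k ∈dom p) → ε ⊢[ mltt ] tmEq (app g (num k)) zero₂ N₂)

IsLeastZero : Tm 0 → ℕ → Set
IsLeastZero g k =
  (ε ⊢[ mltt ] tmEq (app g (num k)) zero₂ N₂) ×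
  (∀ j → j < k → ¬ (ε ⊢[ mltt ] tmEq (app g (num j)) zero₂ N₂))

v : ℕ → Tm 0
v k = lam (app (var fz) (pair (num k) ⋆))

-- Replacing the constants by closed terms
-- commutes with renaming and substitution, so every MLTT rule is sent to an instance of itself.
-- The rules for f hold because g is compatible with the current condition, and the rule for w
-- because g n_g = 0 makes (n_g, ⋆) a witness of Σ x. IsZero (g x).  Locality is sound because g, being 0 off the domain of p, stays compatible along the
-- branch of any partition of p that always extends by 0.  For the second part take g = λx.0,
-- which is compatible with ∅ with n_g = 0; replacement is the identity on constant-free judgments.
module Submission where

open import Defs
open import Data.Nat using (ℕ; zero; suc)
open import Data.Fin using (Fin) renaming (zero to fz; suc to fs)
open import Data.Bool using (false; true)
open import Data.List.Membership.Propositional using (_∈_)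
open import Data.List.Membership.Propositional.Properties using (∈-++⁺ˡ)
open import Data.List.Relation.Unary.Any using (here; there)
open import Data.Product using (_×_; _,_; proj₁; ∃)
open import Function using (_∘_)
open import Relation.Nullary using (¬_)
open import Relation.Binary.PropositionalEquality
  using (_≡_; _≗_; refl; sym; trans; cong; cong₂; subst₂; module ≡-Reasoning)

cong₃ : ∀ {A B C D : Set} (f : A → B → C → D) {a a' b b' c c'} →
        a ≡ a' → b ≡ b' → c ≡ c' → f a b c ≡ f a' b' c'
cong₃ f refl refl refl = refl

cong₄ : ∀ {A B C D E : Set} (f : A → B → C → D → E) {a a' b b' c c' d d'} →
        a ≡ a' → b ≡ b' → c ≡ c' → d ≡ d' → f a b c d ≡ f a' b' c' d'
cong₄ f refl refl refl refl = refl

lifts-var : ∀ {m n} {σ : Fin m → Tm n} {ρ : Fin m → Fin n} →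
            σ ≗ var ∘ ρ → lifts σ ≗ var ∘ liftr ρ
lifts-var h fz = refl
lifts-var h (fs x) = cong wk (h x)

sub-var : ∀ {m n} {σ : Fin m → Tm n} {ρ : Fin m → Fin n} → σ ≗ var ∘ ρ → sub σ ≗ ren ρ
sub-var h (var x) = h x
sub-var h U = refl
sub-var h (Π A B) = cong₂ Π (sub-var h A) (sub-var (lifts-var h) B)
sub-var h (Σ A B) = cong₂ Σ (sub-var h A) (sub-var (lifts-var h) B)
sub-var h (lam t) = cong lam (sub-var (lifts-var h) t)
sub-var h (app t u) = cong₂ app (sub-var h t) (sub-var h u)
sub-var h (pair t u) = cong₂ pair (sub-var h t) (sub-var h u)
sub-var h (fst t) = cong fst (sub-var h t)
sub-var h (snd t) = cong snd (sub-var h t)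
sub-var h N₀ = refl
sub-var h N₁ = refl
sub-var h N₂ = refl
sub-var h N = refl
sub-var h (rec₀ C t) = cong₂ rec₀ (sub-var (lifts-var h) C) (sub-var h t)
sub-var h ⋆ = refl
sub-var h (rec₁ C c t) = cong₃ rec₁ (sub-var (lifts-var h) C) (sub-var h c) (sub-var h t)
sub-var h zero₂ = refl
sub-var h one₂ = refl
sub-var h (rec₂ C a b t) =
  cong₄ rec₂ (sub-var (lifts-var h) C) (sub-var h a) (sub-var h b) (sub-var h t)
sub-var h zeroN = refl
sub-var h (sucN t) = cong sucN (sub-var h t)
sub-var h (recN C z s t) =
  cong₄ recN (sub-var (lifts-var h) C) (sub-var h z) (sub-var (lifts-var (lifts-var h)) s) (sub-var h t)
sub-var h cf = refl
sub-var h cw = refl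

lifts-liftr : ∀ {m n k} {σ : Fin n → Tm k} {ρ : Fin m → Fin n} {τ : Fin m → Tm k} →
              σ ∘ ρ ≗ τ → lifts σ ∘ liftr ρ ≗ lifts τ
lifts-liftr h fz = refl
lifts-liftr h (fs x) = cong wk (h x)

sub-ren : ∀ {m n k} {σ : Fin n → Tm k} {ρ : Fin m → Fin n} {τ : Fin m → Tm k} →
          σ ∘ ρ ≗ τ → sub σ ∘ ren ρ ≗ sub τ
sub-ren h (var x) = h x
sub-ren h U = refl
sub-ren h (Π A B) = cong₂ Π (sub-ren h A) (sub-ren (lifts-liftr h) B)
sub-ren h (Σ A B) = cong₂ Σ (sub-ren h A) (sub-ren (lifts-liftr h) B)
sub-ren h (lam t) = cong lam (sub-ren (lifts-liftr h) t)
sub-ren h (app t u) = cong₂ app (sub-ren h t) (sub-ren h u)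
sub-ren h (pair t u) = cong₂ pair (sub-ren h t) (sub-ren h u)
sub-ren h (fst t) = cong fst (sub-ren h t)
sub-ren h (snd t) = cong snd (sub-ren h t)
sub-ren h N₀ = refl
sub-ren h N₁ = refl
sub-ren h N₂ = refl
sub-ren h N = refl
sub-ren h (rec₀ C t) = cong₂ rec₀ (sub-ren (lifts-liftr h) C) (sub-ren h t)
sub-ren h ⋆ = refl
sub-ren h (rec₁ C c t) = cong₃ rec₁ (sub-ren (lifts-liftr h) C) (sub-ren h c) (sub-ren h t)
sub-ren h zero₂ = refl
sub-ren h one₂ = refl
sub-ren h (rec₂ C a b t) =
  cong₄ rec₂ (sub-ren (lifts-liftr h) C) (sub-ren h a) (sub-ren h b) (sub-ren h t)
sub-ren h zeroN = refl
sub-ren h (sucN t) = cong sucN (sub-ren h t)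
sub-ren h (recN C z s t) =
  cong₄ recN (sub-ren (lifts-liftr h) C) (sub-ren h z) (sub-ren (lifts-liftr (lifts-liftr h)) s) (sub-ren h t)
sub-ren h cf = refl
sub-ren h cw = refl

ren-cong : ∀ {m n} {ρ ρ' : Fin m → Fin n} → ρ ≗ ρ' → ren ρ ≗ ren ρ'
ren-cong {ρ = ρ} h t = trans (sym (sub-var {ρ = ρ} (λ _ → refl) t)) (sub-var (cong var ∘ h) t)

ren-ren : ∀ {m n k} {ρ₁ : Fin n → Fin k} {ρ₂ : Fin m → Fin n} {ρ : Fin m → Fin k} →
          ρ₁ ∘ ρ₂ ≗ ρ → ren ρ₁ ∘ ren ρ₂ ≗ ren ρ
ren-ren {ρ₁ = ρ₁} {ρ₂} h t = begin
  ren ρ₁ (ren ρ₂ t)             ≡⟨ sub-var {ρ = ρ₁} (λ _ → refl) (ren ρ₂ t) ⟨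
  sub (var ∘ ρ₁) (ren ρ₂ t)     ≡⟨ sub-ren (λ _ → refl) t ⟩
  sub (var ∘ (ρ₁ ∘ ρ₂)) t       ≡⟨ sub-var (cong var ∘ h) t ⟩
  ren _ t                       ∎
  where open ≡-Reasoning

ren-wk : ∀ {m n} (ρ : Fin m → Fin n) → ren (liftr ρ) ∘ wk ≗ wk ∘ ren ρ
ren-wk ρ t = trans (ren-ren (λ _ → refl) t) (sym (ren-ren (λ _ → refl) t))

liftr-lifts : ∀ {m n k} {ρ : Fin n → Fin k} {σ : Fin m → Tm n} {τ : Fin m → Tm k} →
              ren ρ ∘ σ ≗ τ → ren (liftr ρ) ∘ lifts σ ≗ lifts τ
liftr-lifts h fz = refl
liftr-lifts {ρ = ρ} {σ} h (fs x) = trans (ren-wk ρ (σ x)) (cong wk (h x))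

ren-sub : ∀ {m n k} {ρ : Fin n → Fin k} {σ : Fin m → Tm n} {τ : Fin m → Tm k} →
          ren ρ ∘ σ ≗ τ → ren ρ ∘ sub σ ≗ sub τ
ren-sub h (var x) = h x
ren-sub h U = refl
ren-sub h (Π A B) = cong₂ Π (ren-sub h A) (ren-sub (liftr-lifts h) B)
ren-sub h (Σ A B) = cong₂ Σ (ren-sub h A) (ren-sub (liftr-lifts h) B)
ren-sub h (lam t) = cong lam (ren-sub (liftr-lifts h) t)
ren-sub h (app t u) = cong₂ app (ren-sub h t) (ren-sub h u)
ren-sub h (pair t u) = cong₂ pair (ren-sub h t) (ren-sub h u)
ren-sub h (fst t) = cong fst (ren-sub h t)
ren-sub h (snd t) = cong snd (ren-sub h t)
ren-sub h N₀ = refl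
ren-sub h N₁ = refl
ren-sub h N₂ = refl
ren-sub h N = refl
ren-sub h (rec₀ C t) = cong₂ rec₀ (ren-sub (liftr-lifts h) C) (ren-sub h t)
ren-sub h ⋆ = refl
ren-sub h (rec₁ C c t) = cong₃ rec₁ (ren-sub (liftr-lifts h) C) (ren-sub h c) (ren-sub h t)
ren-sub h zero₂ = refl
ren-sub h one₂ = refl
ren-sub h (rec₂ C a b t) =
  cong₄ rec₂ (ren-sub (liftr-lifts h) C) (ren-sub h a) (ren-sub h b) (ren-sub h t)
ren-sub h zeroN = refl
ren-sub h (sucN t) = cong sucN (ren-sub h t)
ren-sub h (recN C z s t) =
  cong₄ recN (ren-sub (liftr-lifts h) C) (ren-sub h z) (ren-sub (liftr-lifts (liftr-lifts h)) s) (ren-sub h t)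
ren-sub h cf = refl
ren-sub h cw = refl

ren-sub-comm : ∀ {m m' n k} {ρ : Fin n → Fin k} {σ : Fin m → Tm n}
                 {ρ' : Fin m → Fin m'} {σ' : Fin m' → Tm k} →
               ren ρ ∘ σ ≗ σ' ∘ ρ' → ren ρ ∘ sub σ ≗ sub σ' ∘ ren ρ'
ren-sub-comm h t = trans (ren-sub h t) (sym (sub-ren (λ _ → refl) t))

-- _[_]₀, _[_,_]₁ and stepTy substitute along a where-bound map; up to η it is λ x → var x [ u ]₀ etc.
ren-[]₀ : ∀ {m n} (ρ : Fin m → Fin n) (B : Tm (suc m)) (u : Tm m) →
          ren ρ (B [ u ]₀) ≡ ren (liftr ρ) B [ ren ρ u ]₀
ren-[]₀ ρ B u = ren-sub-comm h B
  where
  h : ren ρ ∘ (λ x → var x [ u ]₀) ≗ (λ x → var x [ ren ρ u ]₀) ∘ liftr ρ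
  h fz = refl
  h (fs i) = refl

ren-[,]₁ : ∀ {m n} (ρ : Fin m → Fin n) (s : Tm (suc (suc m))) (a b : Tm m) →
           ren ρ (s [ a , b ]₁) ≡ ren (liftr (liftr ρ)) s [ ren ρ a , ren ρ b ]₁
ren-[,]₁ ρ s a b = ren-sub-comm h s
  where
  h : ren ρ ∘ (λ x → var x [ a , b ]₁) ≗ (λ x → var x [ ren ρ a , ren ρ b ]₁) ∘ liftr (liftr ρ)
  h fz = refl
  h (fs fz) = refl
  h (fs (fs i)) = refl

ren-stepTy : ∀ {m n} (ρ : Fin m → Fin n) (C : Tm (suc m)) →
             ren (liftr (liftr ρ)) (stepTy C) ≡ stepTy (ren (liftr ρ) C)
ren-stepTy ρ C = ren-sub-comm h C
  where
  h : ren (liftr (liftr ρ)) ∘ (λ x → stepTy (var x)) ≗ (λ x → stepTy (var x)) ∘ liftr ρ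
  h fz = refl
  h (fs i) = refl

ren-num : ∀ {m n} (ρ : Fin m → Fin n) k → ren ρ (num k) ≡ num k
ren-num ρ zero = refl
ren-num ρ (suc k) = cong sucN (ren-num ρ k)

ren-bit : ∀ {m n} (ρ : Fin m → Fin n) b → ren ρ (bit b) ≡ bit b
ren-bit ρ false = refl
ren-bit ρ true = refl

ren-closed : ∀ {n} (ρ : Fin 0 → Fin n) → ren ρ ≗ close
ren-closed ρ = ren-cong (λ ())

ren-close : ∀ {m n} (ρ : Fin m → Fin n) → ren ρ ∘ close ≗ close
ren-close ρ = ren-ren (λ ())

sub-close : ∀ {m n} (σ : Fin m → Tm n) → sub σ ∘ close ≗ close
sub-close σ t =
  trans (sub-ren {τ = var ∘ ρ} (λ ()) t) (trans (sub-var (λ _ → refl) t) (ren-closed ρ t))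
  where
  ρ : Fin 0 → Fin _
  ρ ()

module Replacement (g w : Tm 0) where

  repl-ren : ∀ {m n} (ρ : Fin m → Fin n) → repl g w ∘ ren ρ ≗ ren ρ ∘ repl g w
  repl-ren ρ (var x) = refl
  repl-ren ρ U = refl
  repl-ren ρ (Π A B) = cong₂ Π (repl-ren ρ A) (repl-ren (liftr ρ) B)
  repl-ren ρ (Σ A B) = cong₂ Σ (repl-ren ρ A) (repl-ren (liftr ρ) B)
  repl-ren ρ (lam t) = cong lam (repl-ren (liftr ρ) t)
  repl-ren ρ (app t u) = cong₂ app (repl-ren ρ t) (repl-ren ρ u)
  repl-ren ρ (pair t u) = cong₂ pair (repl-ren ρ t) (repl-ren ρ u)
  repl-ren ρ (fst t) = cong fst (repl-ren ρ t)
  repl-ren ρ (snd t) = cong snd (repl-ren ρ t)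
  repl-ren ρ N₀ = refl
  repl-ren ρ N₁ = refl
  repl-ren ρ N₂ = refl
  repl-ren ρ N = refl
  repl-ren ρ (rec₀ C t) = cong₂ rec₀ (repl-ren (liftr ρ) C) (repl-ren ρ t)
  repl-ren ρ ⋆ = refl
  repl-ren ρ (rec₁ C c t) = cong₃ rec₁ (repl-ren (liftr ρ) C) (repl-ren ρ c) (repl-ren ρ t)
  repl-ren ρ zero₂ = refl
  repl-ren ρ one₂ = refl
  repl-ren ρ (rec₂ C a b t) =
    cong₄ rec₂ (repl-ren (liftr ρ) C) (repl-ren ρ a) (repl-ren ρ b) (repl-ren ρ t)
  repl-ren ρ zeroN = refl
  repl-ren ρ (sucN t) = cong sucN (repl-ren ρ t)
  repl-ren ρ (recN C z s t) =
    cong₄ recN (repl-ren (liftr ρ) C) (repl-ren ρ z) (repl-ren (liftr (liftr ρ)) s) (repl-ren ρ t)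
  repl-ren ρ cf = sym (ren-close ρ g)
  repl-ren ρ cw = sym (ren-close ρ w)

  repl-wk : ∀ {n} → repl g w ∘ wk {n} ≗ wk ∘ repl g w
  repl-wk = repl-ren fs

  repl-lifts : ∀ {m n} {σ τ : Fin m → Tm n} → repl g w ∘ σ ≗ τ → repl g w ∘ lifts σ ≗ lifts τ
  repl-lifts h fz = refl
  repl-lifts {σ = σ} h (fs x) = trans (repl-wk (σ x)) (cong wk (h x))

  repl-sub : ∀ {m n} {σ τ : Fin m → Tm n} → repl g w ∘ σ ≗ τ → repl g w ∘ sub σ ≗ sub τ ∘ repl g w
  repl-sub h (var x) = h x
  repl-sub h U = refl
  repl-sub h (Π A B) = cong₂ Π (repl-sub h A) (repl-sub (repl-lifts h) B)
  repl-sub h (Σ A B) = cong₂ Σ (repl-sub h A) (repl-sub (repl-lifts h) B)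
  repl-sub h (lam t) = cong lam (repl-sub (repl-lifts h) t)
  repl-sub h (app t u) = cong₂ app (repl-sub h t) (repl-sub h u)
  repl-sub h (pair t u) = cong₂ pair (repl-sub h t) (repl-sub h u)
  repl-sub h (fst t) = cong fst (repl-sub h t)
  repl-sub h (snd t) = cong snd (repl-sub h t)
  repl-sub h N₀ = refl
  repl-sub h N₁ = refl
  repl-sub h N₂ = refl
  repl-sub h N = refl
  repl-sub h (rec₀ C t) = cong₂ rec₀ (repl-sub (repl-lifts h) C) (repl-sub h t)
  repl-sub h ⋆ = refl
  repl-sub h (rec₁ C c t) = cong₃ rec₁ (repl-sub (repl-lifts h) C) (repl-sub h c) (repl-sub h t)
  repl-sub h zero₂ = refl
  repl-sub h one₂ = refl
  repl-sub h (rec₂ C a b t) =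
    cong₄ rec₂ (repl-sub (repl-lifts h) C) (repl-sub h a) (repl-sub h b) (repl-sub h t)
  repl-sub h zeroN = refl
  repl-sub h (sucN t) = cong sucN (repl-sub h t)
  repl-sub h (recN C z s t) =
    cong₄ recN (repl-sub (repl-lifts h) C) (repl-sub h z) (repl-sub (repl-lifts (repl-lifts h)) s) (repl-sub h t)
  repl-sub {τ = τ} h cf = sym (sub-close τ g)
  repl-sub {τ = τ} h cw = sym (sub-close τ w)

  repl-[]₀ : ∀ {m} (B : Tm (suc m)) (u : Tm m) → repl g w (B [ u ]₀) ≡ repl g w B [ repl g w u ]₀
  repl-[]₀ B u = repl-sub h B
    where
    h : repl g w ∘ (λ x → var x [ u ]₀) ≗ (λ x → var x [ repl g w u ]₀)
    h fz = refl
    h (fs i) = refl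

  repl-[,]₁ : ∀ {m} (s : Tm (suc (suc m))) (a b : Tm m) →
              repl g w (s [ a , b ]₁) ≡ repl g w s [ repl g w a , repl g w b ]₁
  repl-[,]₁ s a b = repl-sub h s
    where
    h : repl g w ∘ (λ x → var x [ a , b ]₁) ≗ (λ x → var x [ repl g w a , repl g w b ]₁)
    h fz = refl
    h (fs fz) = refl
    h (fs (fs i)) = refl

  repl-stepTy : ∀ {m} (C : Tm (suc m)) → repl g w (stepTy C) ≡ stepTy (repl g w C)
  repl-stepTy C = repl-sub h C
    where
    h : repl g w ∘ (λ x → stepTy (var x)) ≗ (λ x → stepTy (var x))
    h fz = refl
    h (fs i) = refl

  repl-num : ∀ {m} k → repl g w (num {m} k) ≡ num k
  repl-num zero = refl
  repl-num (suc k) = cong sucN (repl-num k)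

  repl-bit : ∀ {m} b → repl g w (bit {m} b) ≡ bit b
  repl-bit false = refl
  repl-bit true = refl

  repl-constFree : ∀ {m} (t : Tm m) → ConstFree t → repl g w t ≡ t
  repl-constFree (var x) _ = refl
  repl-constFree U _ = refl
  repl-constFree (Π A B) (hA , hB) = cong₂ Π (repl-constFree A hA) (repl-constFree B hB)
  repl-constFree (Σ A B) (hA , hB) = cong₂ Σ (repl-constFree A hA) (repl-constFree B hB)
  repl-constFree (lam t) ht = cong lam (repl-constFree t ht)
  repl-constFree (app t u) (ht , hu) = cong₂ app (repl-constFree t ht) (repl-constFree u hu)
  repl-constFree (pair t u) (ht , hu) = cong₂ pair (repl-constFree t ht) (repl-constFree u hu)
  repl-constFree (fst t) ht = cong fst (repl-constFree t ht)
  repl-constFree (snd t) ht = cong snd (repl-constFree t ht)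
  repl-constFree N₀ _ = refl
  repl-constFree N₁ _ = refl
  repl-constFree N₂ _ = refl
  repl-constFree N _ = refl
  repl-constFree (rec₀ C t) (hC , ht) = cong₂ rec₀ (repl-constFree C hC) (repl-constFree t ht)
  repl-constFree ⋆ _ = refl
  repl-constFree (rec₁ C c t) (hC , hc , ht) =
    cong₃ rec₁ (repl-constFree C hC) (repl-constFree c hc) (repl-constFree t ht)
  repl-constFree zero₂ _ = refl
  repl-constFree one₂ _ = refl
  repl-constFree (rec₂ C a b t) (hC , ha , hb , ht) =
    cong₄ rec₂ (repl-constFree C hC) (repl-constFree a ha) (repl-constFree b hb) (repl-constFree t ht)
  repl-constFree zeroN _ = refl
  repl-constFree (sucN t) ht = cong sucN (repl-constFree t ht)
  repl-constFree (recN C z s t) (hC , hz , hs , ht) =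
    cong₄ recN (repl-constFree C hC) (repl-constFree z hz) (repl-constFree s hs) (repl-constFree t ht)

  replCon-constFree : ∀ {n} (Γ : Con n) → ConstFreeCon Γ → replCon g w Γ ≡ Γ
  replCon-constFree ε _ = refl
  replCon-constFree (Γ ∙ A) (hΓ , hA) = cong₂ _∙_ (replCon-constFree Γ hΓ) (repl-constFree A hA)

  replJ-constFree : ∀ {n} (J : Jdg n) → ConstFreeJ J → replJ g w J ≡ J
  replJ-constFree ctx _ = refl
  replJ-constFree (ty A) hA = cong ty (repl-constFree A hA)
  replJ-constFree (tyEq A B) (hA , hB) = cong₂ tyEq (repl-constFree A hA) (repl-constFree B hB)
  replJ-constFree (tm t A) (ht , hA) = cong₂ tm (repl-constFree t ht) (repl-constFree A hA)
  replJ-constFree (tmEq t u A) (ht , hu , hA) =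
    cong₃ tmEq (repl-constFree t ht) (repl-constFree u hu) (repl-constFree A hA)

module _ {m : Mode} {n} {Γ : Con n} where

  tm≡ : ∀ {t t' A} → t ≡ t' → Γ ⊢[ m ] tm t A → Γ ⊢[ m ] tm t' A
  tm≡ refl d = d

  conv≡ : ∀ {t A A'} → A ≡ A' → Γ ⊢[ m ] tm t A → Γ ⊢[ m ] tm t A'
  conv≡ refl d = d

  tmEq≡ : ∀ {t t' u u' A} → t ≡ t' → u ≡ u' → Γ ⊢[ m ] tmEq t u A → Γ ⊢[ m ] tmEq t' u' A
  tmEq≡ refl refl d = d

  conv-eq≡ : ∀ {t u A A'} → A ≡ A' → Γ ⊢[ m ] tmEq t u A → Γ ⊢[ m ] tmEq t u A'
  conv-eq≡ refl d = d

∈ᶜ≡ : ∀ {n} {Γ : Con n} {x A A'} → A ≡ A' → x ⦂ A ∈ᶜ Γ → x ⦂ A' ∈ᶜ Γ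
∈ᶜ≡ refl x = x

renJ : ∀ {n k} → (Fin n → Fin k) → Jdg n → Jdg k
renJ ρ ctx = ctx
renJ ρ (ty A) = ty (ren ρ A)
renJ ρ (tyEq A B) = tyEq (ren ρ A) (ren ρ B)
renJ ρ (tm t A) = tm (ren ρ t) (ren ρ A)
renJ ρ (tmEq t u A) = tmEq (ren ρ t) (ren ρ u) (ren ρ A)

data Wk : ∀ {n k} → (Fin n → Fin k) → Con n → Con k → Set where
  from-ε : ∀ {k} {Δ : Con k} {ρ : Fin 0 → Fin k} → Δ ⊢[ mltt ] ctx → Wk ρ ε Δ
  lift   : ∀ {n k} {ρ : Fin n → Fin k} {Γ : Con n} {Δ : Con k} {A} →
           Wk ρ Γ Δ → Wk (liftr ρ) (Γ ∙ A) (Δ ∙ ren ρ A)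

ren-∈ᶜ : ∀ {n k} {ρ : Fin n → Fin k} {Γ : Con n} {Δ : Con k} {x A} →
         Wk ρ Γ Δ → x ⦂ A ∈ᶜ Γ → ρ x ⦂ ren ρ A ∈ᶜ Δ
ren-∈ᶜ (from-ε c) ()
ren-∈ᶜ (lift {ρ = ρ} {A = A} w) here = ∈ᶜ≡ (sym (ren-wk ρ A)) here
ren-∈ᶜ (lift {ρ = ρ} w) (there {A = A} x) = ∈ᶜ≡ (sym (ren-wk ρ A)) (there (ren-∈ᶜ w x))

ren-⊢ : ∀ {n k} {ρ : Fin n → Fin k} {Γ : Con n} {Δ : Con k} {J} →
        Wk ρ Γ Δ → Γ ⊢[ mltt ] J → Δ ⊢[ mltt ] renJ ρ J
ren-⊢ (from-ε c) ε-wf = c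
ren-⊢ (lift w) (∙-wf d) = ∙-wf (ren-⊢ w d)
ren-⊢ w (var-tm c x) = var-tm (ren-⊢ w c) (ren-∈ᶜ w x)
ren-⊢ w (U-ty d) = U-ty (ren-⊢ w d)
ren-⊢ w (univ d) = univ (ren-⊢ w d)
ren-⊢ w (Π-ty d e) = Π-ty (ren-⊢ w d) (ren-⊢ (lift w) e)
ren-⊢ w (Σ-ty d e) = Σ-ty (ren-⊢ w d) (ren-⊢ (lift w) e)
ren-⊢ w (ty-refl d) = ty-refl (ren-⊢ w d)
ren-⊢ w (ty-sym d) = ty-sym (ren-⊢ w d)
ren-⊢ w (ty-trans d e) = ty-trans (ren-⊢ w d) (ren-⊢ w e)
ren-⊢ w (univ-eq d) = univ-eq (ren-⊢ w d)
ren-⊢ w (Π-cong a b c) = Π-cong (ren-⊢ w a) (ren-⊢ w b) (ren-⊢ (lift w) c)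
ren-⊢ w (Σ-cong a b c) = Σ-cong (ren-⊢ w a) (ren-⊢ w b) (ren-⊢ (lift w) c)
ren-⊢ w (Π-U a b) = Π-U (ren-⊢ w a) (ren-⊢ (lift w) b)
ren-⊢ w (Σ-U a b) = Σ-U (ren-⊢ w a) (ren-⊢ (lift w) b)
ren-⊢ w (N₀-U c) = N₀-U (ren-⊢ w c)
ren-⊢ w (N₁-U c) = N₁-U (ren-⊢ w c)
ren-⊢ w (N₂-U c) = N₂-U (ren-⊢ w c)
ren-⊢ w (N-U c) = N-U (ren-⊢ w c)
ren-⊢ w (conv a b) = conv (ren-⊢ w a) (ren-⊢ w b)
ren-⊢ w (lam-tm a b) = lam-tm (ren-⊢ w a) (ren-⊢ (lift w) b)
ren-⊢ {ρ = ρ} w (app-tm {B = B} {u = u} a b) =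
  conv≡ (sym (ren-[]₀ ρ B u)) (app-tm (ren-⊢ w a) (ren-⊢ w b))
ren-⊢ {ρ = ρ} w (pair-tm {B = B} {t = t} a b c d) =
  pair-tm (ren-⊢ w a) (ren-⊢ (lift w) b) (ren-⊢ w c) (conv≡ (ren-[]₀ ρ B t) (ren-⊢ w d))
ren-⊢ w (fst-tm d) = fst-tm (ren-⊢ w d)
ren-⊢ {ρ = ρ} w (snd-tm {B = B} {t = t} d) = conv≡ (sym (ren-[]₀ ρ B (fst t))) (snd-tm (ren-⊢ w d))
ren-⊢ {ρ = ρ} w (rec₀-tm {C = C} {t = t} a b) =
  conv≡ (sym (ren-[]₀ ρ C t)) (rec₀-tm (ren-⊢ (lift w) a) (ren-⊢ w b))
ren-⊢ w (⋆-tm c) = ⋆-tm (ren-⊢ w c)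
ren-⊢ {ρ = ρ} w (rec₁-tm {C = C} {t = t} a b d) =
  conv≡ (sym (ren-[]₀ ρ C t))
    (rec₁-tm (ren-⊢ (lift w) a) (conv≡ (ren-[]₀ ρ C ⋆) (ren-⊢ w b)) (ren-⊢ w d))
ren-⊢ w (zero₂-tm c) = zero₂-tm (ren-⊢ w c)
ren-⊢ w (one₂-tm c) = one₂-tm (ren-⊢ w c)
ren-⊢ {ρ = ρ} w (rec₂-tm {C = C} {t = t} a b c d) =
  conv≡ (sym (ren-[]₀ ρ C t))
    (rec₂-tm (ren-⊢ (lift w) a)
       (conv≡ (ren-[]₀ ρ C zero₂) (ren-⊢ w b))
       (conv≡ (ren-[]₀ ρ C one₂) (ren-⊢ w c))
       (ren-⊢ w d))
ren-⊢ w (zeroN-tm c) = zeroN-tm (ren-⊢ w c)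
ren-⊢ w (sucN-tm d) = sucN-tm (ren-⊢ w d)
ren-⊢ {ρ = ρ} w (recN-tm {C = C} {t = t} a b c d) =
  conv≡ (sym (ren-[]₀ ρ C t))
    (recN-tm (ren-⊢ (lift w) a)
       (conv≡ (ren-[]₀ ρ C zeroN) (ren-⊢ w b))
       (conv≡ (ren-stepTy ρ C) (ren-⊢ (lift (lift w)) c))
       (ren-⊢ w d))
ren-⊢ w (tm-refl d) = tm-refl (ren-⊢ w d)
ren-⊢ w (tm-sym d) = tm-sym (ren-⊢ w d)
ren-⊢ w (tm-trans d e) = tm-trans (ren-⊢ w d) (ren-⊢ w e)
ren-⊢ w (conv-eq d e) = conv-eq (ren-⊢ w d) (ren-⊢ w e)
ren-⊢ w (Π-cong-U a b c) = Π-cong-U (ren-⊢ w a) (ren-⊢ w b) (ren-⊢ (lift w) c)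
ren-⊢ w (Σ-cong-U a b c) = Σ-cong-U (ren-⊢ w a) (ren-⊢ w b) (ren-⊢ (lift w) c)
ren-⊢ w (lam-cong a b) = lam-cong (ren-⊢ w a) (ren-⊢ (lift w) b)
ren-⊢ {ρ = ρ} w (app-cong {B = B} {u = u} a b) =
  conv-eq≡ (sym (ren-[]₀ ρ B u)) (app-cong (ren-⊢ w a) (ren-⊢ w b))
ren-⊢ {ρ = ρ} w (pair-cong {B = B} {t = t} a b c d) =
  pair-cong (ren-⊢ w a) (ren-⊢ (lift w) b) (ren-⊢ w c) (conv-eq≡ (ren-[]₀ ρ B t) (ren-⊢ w d))
ren-⊢ w (fst-cong d) = fst-cong (ren-⊢ w d)
ren-⊢ {ρ = ρ} w (snd-cong {B = B} {t = t} d) =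
  conv-eq≡ (sym (ren-[]₀ ρ B (fst t))) (snd-cong (ren-⊢ w d))
ren-⊢ {ρ = ρ} w (rec₀-cong {C = C} {t = t} a b) =
  conv-eq≡ (sym (ren-[]₀ ρ C t)) (rec₀-cong (ren-⊢ (lift w) a) (ren-⊢ w b))
ren-⊢ {ρ = ρ} w (rec₁-cong {C = C} {t = t} a b c) =
  conv-eq≡ (sym (ren-[]₀ ρ C t))
    (rec₁-cong (ren-⊢ (lift w) a) (conv-eq≡ (ren-[]₀ ρ C ⋆) (ren-⊢ w b)) (ren-⊢ w c))
ren-⊢ {ρ = ρ} w (rec₂-cong {C = C} {t = t} a b c d) =
  conv-eq≡ (sym (ren-[]₀ ρ C t))
    (rec₂-cong (ren-⊢ (lift w) a)
       (conv-eq≡ (ren-[]₀ ρ C zero₂) (ren-⊢ w b))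
       (conv-eq≡ (ren-[]₀ ρ C one₂) (ren-⊢ w c))
       (ren-⊢ w d))
ren-⊢ w (sucN-cong d) = sucN-cong (ren-⊢ w d)
ren-⊢ {ρ = ρ} w (recN-cong {C = C} {t = t} a b c d) =
  conv-eq≡ (sym (ren-[]₀ ρ C t))
    (recN-cong (ren-⊢ (lift w) a)
       (conv-eq≡ (ren-[]₀ ρ C zeroN) (ren-⊢ w b))
       (conv-eq≡ (ren-stepTy ρ C) (ren-⊢ (lift (lift w)) c))
       (ren-⊢ w d))
ren-⊢ {ρ = ρ} w (Π-β {B = B} {t = t} {u = u} a b c) =
  conv-eq≡ (sym (ren-[]₀ ρ B u))
    (tmEq≡ refl (sym (ren-[]₀ ρ t u)) (Π-β (ren-⊢ w a) (ren-⊢ (lift w) b) (ren-⊢ w c)))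
ren-⊢ {ρ = ρ} w (Π-η {t = t} {t' = t'} a b c d) =
  Π-η (ren-⊢ w a)
    (ren-⊢ w b)
    (ren-⊢ w c)
    (tmEq≡ (cong (λ X → app X (var fz)) (ren-wk ρ t))
       (cong (λ X → app X (var fz)) (ren-wk ρ t'))
       (ren-⊢ (lift w) d))
ren-⊢ {ρ = ρ} w (Σ-β₁ {B = B} {t = t} a b c d) =
  Σ-β₁ (ren-⊢ w a) (ren-⊢ (lift w) b) (ren-⊢ w c) (conv≡ (ren-[]₀ ρ B t) (ren-⊢ w d))
ren-⊢ {ρ = ρ} w (Σ-β₂ {B = B} {t = t} a b c d) =
  conv-eq≡ (sym (ren-[]₀ ρ B t))
    (Σ-β₂ (ren-⊢ w a) (ren-⊢ (lift w) b) (ren-⊢ w c) (conv≡ (ren-[]₀ ρ B t) (ren-⊢ w d)))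
ren-⊢ {ρ = ρ} w (Σ-η {B = B} {t = t} a b c d) =
  Σ-η (ren-⊢ w a) (ren-⊢ w b) (ren-⊢ w c) (conv-eq≡ (ren-[]₀ ρ B (fst t)) (ren-⊢ w d))
ren-⊢ {ρ = ρ} w (rec₁-β {C = C} a b) =
  conv-eq≡ (sym (ren-[]₀ ρ C ⋆)) (rec₁-β (ren-⊢ (lift w) a) (conv≡ (ren-[]₀ ρ C ⋆) (ren-⊢ w b)))
ren-⊢ {ρ = ρ} w (rec₂-β₀ {C = C} a b c) =
  conv-eq≡ (sym (ren-[]₀ ρ C zero₂))
    (rec₂-β₀ (ren-⊢ (lift w) a)
       (conv≡ (ren-[]₀ ρ C zero₂) (ren-⊢ w b))
       (conv≡ (ren-[]₀ ρ C one₂) (ren-⊢ w c)))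
ren-⊢ {ρ = ρ} w (rec₂-β₁ {C = C} a b c) =
  conv-eq≡ (sym (ren-[]₀ ρ C one₂))
    (rec₂-β₁ (ren-⊢ (lift w) a)
       (conv≡ (ren-[]₀ ρ C zero₂) (ren-⊢ w b))
       (conv≡ (ren-[]₀ ρ C one₂) (ren-⊢ w c)))
ren-⊢ {ρ = ρ} w (recN-β₀ {C = C} a b c) =
  conv-eq≡ (sym (ren-[]₀ ρ C zeroN))
    (recN-β₀ (ren-⊢ (lift w) a)
       (conv≡ (ren-[]₀ ρ C zeroN) (ren-⊢ w b))
       (conv≡ (ren-stepTy ρ C) (ren-⊢ (lift (lift w)) c)))
ren-⊢ {ρ = ρ} w (recN-βS {C = C} {z = z} {s = s} {t = t} a b c d) =
  conv-eq≡ (sym (ren-[]₀ ρ C (sucN t)))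
    (tmEq≡ refl (sym (ren-[,]₁ ρ s t (recN C z s t)))
       (recN-βS (ren-⊢ (lift w) a)
          (conv≡ (ren-[]₀ ρ C zeroN) (ren-⊢ w b))
          (conv≡ (ren-stepTy ρ C) (ren-⊢ (lift (lift w)) c))
          (ren-⊢ w d)))

close-tm : ∀ {n} {Δ : Con n} {t A} → Δ ⊢[ mltt ] ctx → ε ⊢[ mltt ] tm t A →
           Δ ⊢[ mltt ] tm (close t) (close A)
close-tm {t = t} {A} c d =
  tm≡ (ren-closed _ t) (conv≡ (ren-closed _ A) (ren-⊢ (from-ε {ρ = λ ()} c) d))

close-tmEq : ∀ {n} {Δ : Con n} {t u A} → Δ ⊢[ mltt ] ctx → ε ⊢[ mltt ] tmEq t u A →
             Δ ⊢[ mltt ] tmEq (close t) (close u) (close A)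
close-tmEq {t = t} {u} {A} c d =
  tmEq≡ (ren-closed _ t) (ren-closed _ u) (conv-eq≡ (ren-closed _ A) (ren-⊢ (from-ε {ρ = λ ()} c) d))

N-ty : ∀ {m n} {Δ : Con n} → Δ ⊢[ m ] ctx → Δ ⊢[ m ] ty N
N-ty c = univ (N-U c)

num-tm : ∀ {m n} {Δ : Con n} → Δ ⊢[ m ] ctx → ∀ k → Δ ⊢[ m ] tm (num k) N
num-tm c zero = zeroN-tm c
num-tm c (suc k) = sucN-tm (num-tm c k)

IsZero-ty : ∀ {m n} {Δ : Con n} {t} → Δ ⊢[ m ] ctx → Δ ⊢[ m ] tm t N₂ → Δ ⊢[ m ] ty (IsZero t)
IsZero-ty c d = univ (rec₂-tm (U-ty (∙-wf (univ (N₂-U c)))) (N₁-U c) (N₀-U c) d)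

IsZero-zero : ∀ {m n} {Δ : Con n} {t} → Δ ⊢[ m ] ctx → Δ ⊢[ m ] tmEq t zero₂ N₂ →
              Δ ⊢[ m ] tyEq (IsZero t) N₁
IsZero-zero c d = univ-eq (tm-trans
  (rec₂-cong (ty-refl ⊢U) (tm-refl (N₁-U c)) (tm-refl (N₀-U c)) d)
  (rec₂-β₀ ⊢U (N₁-U c) (N₀-U c)))
  where ⊢U = U-ty (∙-wf (univ (N₂-U c)))

∃Zero : ∀ {n} → Tm 0 → Tm n
∃Zero g = Σ N (IsZero (app (close g) (var fz)))

ren-∃Zero : ∀ {m n} (ρ : Fin m → Fin n) (g : Tm 0) → ren ρ (∃Zero g) ≡ ∃Zero g
ren-∃Zero ρ g = cong (λ G → Σ N (IsZero (app G (var fz)))) (ren-close (liftr ρ) g)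

wTy≡ : (g : Tm 0) → wTy g ≡ ¬ᵗ (¬ᵗ (∃Zero g))
wTy≡ g = cong (λ G → ¬ᵗ (¬ᵗ (Σ N (IsZero (app G (var fz)))))) (ren-closed fs g)

ren-wTy : ∀ {n} (ρ : Fin 0 → Fin n) (g : Tm 0) → ren ρ (wTy g) ≡ ¬ᵗ (¬ᵗ (∃Zero g))
ren-wTy ρ g = trans (cong (ren ρ) (wTy≡ g)) (cong (¬ᵗ ∘ ¬ᵗ) (ren-∃Zero ρ g))

module _ {g : Tm 0} (⊢g : ε ⊢[ mltt ] tm g (Π N N₂)) where

  IsZero-g-ty : ∀ {n} {Δ : Con n} → Δ ⊢[ mltt ] ctx → (Δ ∙ N) ⊢[ mltt ] ty (IsZero (app (close g) (var fz)))
  IsZero-g-ty c = IsZero-ty cN (app-tm (close-tm cN ⊢g) (var-tm cN here))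
    where cN = ∙-wf (N-ty c)

  ∃Zero-ty : ∀ {n} {Δ : Con n} → Δ ⊢[ mltt ] ctx → Δ ⊢[ mltt ] ty (∃Zero g)
  ∃Zero-ty c = Σ-ty (N-ty c) (IsZero-g-ty c)

  ∃Zero-intro : ∀ {n} {Δ : Con n} {k} → Δ ⊢[ mltt ] ctx →
                ε ⊢[ mltt ] tmEq (app g (num k)) zero₂ N₂ → Δ ⊢[ mltt ] tm (pair (num k) ⋆) (∃Zero g)
  ∃Zero-intro {k = k} c gk≡0 =
    pair-tm (N-ty c) (IsZero-g-ty c) (num-tm c k)
      (conv≡ (cong (λ G → IsZero (app G (num k))) (sym (sub-close _ g)))
        (conv (⋆-tm c) (ty-sym (IsZero-zero c gk≡0′))))
    where
    gk≡0′ : _ ⊢[ mltt ] tmEq (app (close g) (num k)) zero₂ N₂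
    gk≡0′ = tmEq≡ (cong (app (close g)) (ren-num _ k)) refl (close-tmEq c gk≡0)

  v-tm : ∀ {k} → ε ⊢[ mltt ] tmEq (app g (num k)) zero₂ N₂ → ε ⊢[ mltt ] tm (v k) (wTy g)
  v-tm gk≡0 =
    conv≡ (sym (wTy≡ g)) (lam-tm ⊢¬∃Zero (app-tm (conv≡ (cong ¬ᵗ (ren-∃Zero fs g)) (var-tm c here))
                                                 (∃Zero-intro c gk≡0)))
    where
    ⊢¬∃Zero : ε ⊢[ mltt ] ty (¬ᵗ (∃Zero g))
    ⊢¬∃Zero = Π-ty (∃Zero-ty ε-wf) (univ (N₀-U (∙-wf (∃Zero-ty ε-wf))))
    c : (ε ∙ ¬ᵗ (∃Zero g)) ⊢[ mltt ] ctx
    c = ∙-wf ⊢¬∃Zero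

compatible-extend₀ : ∀ {g p} n (n∉ : ¬ (n ∈dom p)) → Compatible g p →
                     Compatible g (extend p n n∉ false)
compatible-extend₀ {g} {p} n n∉ (onDom , offDom) = onDom′ , λ k k∉ → offDom k (k∉ ∘ there)
  where
  onDom′ : ∀ k b → (k , b) ∈ graph (extend p n n∉ false) →
           ε ⊢[ mltt ] tmEq (app g (num k)) (bit b) N₂
  onDom′ k b (here refl) = offDom n n∉
  onDom′ k b (there kb∈p) = onDom k b kb∈p

compatible-partition : ∀ {g p S} → p ◁ S → Compatible g p → ∃ λ q → q ∈ S × Compatible g q
compatible-partition {p = p} ◁refl cp = p , here refl , cp
compatible-partition {g} {p} (◁split {S₀} {S₁} n n∉ p₀◁S₀ _) cp
  with q , q∈S₀ , cq ← compatible-partition p₀◁S₀ (compatible-extend₀ {g} {p} n n∉ cp) =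
  q , ∈-++⁺ˡ {xs = S₀} {ys = S₁} q∈S₀ , cq

module Translation (g w : Tm 0) (⊢g : ε ⊢[ mltt ] tm g (Π N N₂)) (⊢w : ε ⊢[ mltt ] tm w (wTy g))
  where
  open Replacement g w

  repl-∈ᶜ : ∀ {n} {Γ : Con n} {x A} → x ⦂ A ∈ᶜ Γ → x ⦂ repl g w A ∈ᶜ replCon g w Γ
  repl-∈ᶜ (here {A = A}) = ∈ᶜ≡ (sym (repl-wk A)) here
  repl-∈ᶜ (there {A = A} x) = ∈ᶜ≡ (sym (repl-wk A)) (there (repl-∈ᶜ x))

  repl-⊢ : ∀ {p} → Compatible g p → ∀ {n} {Γ : Con n} {J} →
           Γ ⊢[ forc p ] J → replCon g w Γ ⊢[ mltt ] replJ g w J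
  repl-⊢ cp ε-wf = ε-wf
  repl-⊢ cp (∙-wf d) = ∙-wf (repl-⊢ cp d)
  repl-⊢ cp (var-tm d x) = var-tm (repl-⊢ cp d) (repl-∈ᶜ x)
  repl-⊢ cp (locality d p◁S) with q , q∈S , cq ← compatible-partition p◁S cp =
    repl-⊢ cq (d q q∈S)
  repl-⊢ cp (f-tm d) = close-tm (repl-⊢ cp d) ⊢g
  repl-⊢ cp (f-val {k = k} {b = b} d kb∈p) =
    tmEq≡ (cong (app (close g)) (trans (ren-num _ k) (sym (repl-num k))))
          (trans (ren-bit _ b) (sym (repl-bit b)))
      (close-tmEq (repl-⊢ cp d) (proj₁ cp k b kb∈p))
  repl-⊢ cp (w-tm d) = conv≡ (ren-wTy _ g) (close-tm (repl-⊢ cp d) ⊢w)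
  repl-⊢ cp (U-ty d) = U-ty (repl-⊢ cp d)
  repl-⊢ cp (univ d) = univ (repl-⊢ cp d)
  repl-⊢ cp (Π-ty d e) = Π-ty (repl-⊢ cp d) (repl-⊢ cp e)
  repl-⊢ cp (Σ-ty d e) = Σ-ty (repl-⊢ cp d) (repl-⊢ cp e)
  repl-⊢ cp (ty-refl d) = ty-refl (repl-⊢ cp d)
  repl-⊢ cp (ty-sym d) = ty-sym (repl-⊢ cp d)
  repl-⊢ cp (ty-trans d e) = ty-trans (repl-⊢ cp d) (repl-⊢ cp e)
  repl-⊢ cp (univ-eq d) = univ-eq (repl-⊢ cp d)
  repl-⊢ cp (Π-cong a b c) = Π-cong (repl-⊢ cp a) (repl-⊢ cp b) (repl-⊢ cp c)
  repl-⊢ cp (Σ-cong a b c) = Σ-cong (repl-⊢ cp a) (repl-⊢ cp b) (repl-⊢ cp c)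
  repl-⊢ cp (Π-U a b) = Π-U (repl-⊢ cp a) (repl-⊢ cp b)
  repl-⊢ cp (Σ-U a b) = Σ-U (repl-⊢ cp a) (repl-⊢ cp b)
  repl-⊢ cp (N₀-U c) = N₀-U (repl-⊢ cp c)
  repl-⊢ cp (N₁-U c) = N₁-U (repl-⊢ cp c)
  repl-⊢ cp (N₂-U c) = N₂-U (repl-⊢ cp c)
  repl-⊢ cp (N-U c) = N-U (repl-⊢ cp c)
  repl-⊢ cp (conv a b) = conv (repl-⊢ cp a) (repl-⊢ cp b)
  repl-⊢ cp (lam-tm a b) = lam-tm (repl-⊢ cp a) (repl-⊢ cp b)
  repl-⊢ cp (app-tm {B = B} {u = u} a b) =
    conv≡ (sym (repl-[]₀ B u)) (app-tm (repl-⊢ cp a) (repl-⊢ cp b))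
  repl-⊢ cp (pair-tm {B = B} {t = t} a b c d) =
    pair-tm (repl-⊢ cp a) (repl-⊢ cp b) (repl-⊢ cp c) (conv≡ (repl-[]₀ B t) (repl-⊢ cp d))
  repl-⊢ cp (fst-tm d) = fst-tm (repl-⊢ cp d)
  repl-⊢ cp (snd-tm {B = B} {t = t} d) = conv≡ (sym (repl-[]₀ B (fst t))) (snd-tm (repl-⊢ cp d))
  repl-⊢ cp (rec₀-tm {C = C} {t = t} a b) =
    conv≡ (sym (repl-[]₀ C t)) (rec₀-tm (repl-⊢ cp a) (repl-⊢ cp b))
  repl-⊢ cp (⋆-tm c) = ⋆-tm (repl-⊢ cp c)
  repl-⊢ cp (rec₁-tm {C = C} {t = t} a b d) =
    conv≡ (sym (repl-[]₀ C t)) (rec₁-tm (repl-⊢ cp a) (conv≡ (repl-[]₀ C ⋆) (repl-⊢ cp b)) (repl-⊢ cp d))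
  repl-⊢ cp (zero₂-tm c) = zero₂-tm (repl-⊢ cp c)
  repl-⊢ cp (one₂-tm c) = one₂-tm (repl-⊢ cp c)
  repl-⊢ cp (rec₂-tm {C = C} {t = t} a b c d) =
    conv≡ (sym (repl-[]₀ C t))
      (rec₂-tm (repl-⊢ cp a)
         (conv≡ (repl-[]₀ C zero₂) (repl-⊢ cp b))
         (conv≡ (repl-[]₀ C one₂) (repl-⊢ cp c))
         (repl-⊢ cp d))
  repl-⊢ cp (zeroN-tm c) = zeroN-tm (repl-⊢ cp c)
  repl-⊢ cp (sucN-tm d) = sucN-tm (repl-⊢ cp d)
  repl-⊢ cp (recN-tm {C = C} {t = t} a b c d) =
    conv≡ (sym (repl-[]₀ C t))
      (recN-tm (repl-⊢ cp a)
         (conv≡ (repl-[]₀ C zeroN) (repl-⊢ cp b))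
         (conv≡ (repl-stepTy C) (repl-⊢ cp c))
         (repl-⊢ cp d))
  repl-⊢ cp (tm-refl d) = tm-refl (repl-⊢ cp d)
  repl-⊢ cp (tm-sym d) = tm-sym (repl-⊢ cp d)
  repl-⊢ cp (tm-trans d e) = tm-trans (repl-⊢ cp d) (repl-⊢ cp e)
  repl-⊢ cp (conv-eq d e) = conv-eq (repl-⊢ cp d) (repl-⊢ cp e)
  repl-⊢ cp (Π-cong-U a b c) = Π-cong-U (repl-⊢ cp a) (repl-⊢ cp b) (repl-⊢ cp c)
  repl-⊢ cp (Σ-cong-U a b c) = Σ-cong-U (repl-⊢ cp a) (repl-⊢ cp b) (repl-⊢ cp c)
  repl-⊢ cp (lam-cong a b) = lam-cong (repl-⊢ cp a) (repl-⊢ cp b)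
  repl-⊢ cp (app-cong {B = B} {u = u} a b) =
    conv-eq≡ (sym (repl-[]₀ B u)) (app-cong (repl-⊢ cp a) (repl-⊢ cp b))
  repl-⊢ cp (pair-cong {B = B} {t = t} a b c d) =
    pair-cong (repl-⊢ cp a) (repl-⊢ cp b) (repl-⊢ cp c) (conv-eq≡ (repl-[]₀ B t) (repl-⊢ cp d))
  repl-⊢ cp (fst-cong d) = fst-cong (repl-⊢ cp d)
  repl-⊢ cp (snd-cong {B = B} {t = t} d) = conv-eq≡ (sym (repl-[]₀ B (fst t))) (snd-cong (repl-⊢ cp d))
  repl-⊢ cp (rec₀-cong {C = C} {t = t} a b) =
    conv-eq≡ (sym (repl-[]₀ C t)) (rec₀-cong (repl-⊢ cp a) (repl-⊢ cp b))
  repl-⊢ cp (rec₁-cong {C = C} {t = t} a b c) =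
    conv-eq≡ (sym (repl-[]₀ C t))
      (rec₁-cong (repl-⊢ cp a) (conv-eq≡ (repl-[]₀ C ⋆) (repl-⊢ cp b)) (repl-⊢ cp c))
  repl-⊢ cp (rec₂-cong {C = C} {t = t} a b c d) =
    conv-eq≡ (sym (repl-[]₀ C t))
      (rec₂-cong (repl-⊢ cp a)
         (conv-eq≡ (repl-[]₀ C zero₂) (repl-⊢ cp b))
         (conv-eq≡ (repl-[]₀ C one₂) (repl-⊢ cp c))
         (repl-⊢ cp d))
  repl-⊢ cp (sucN-cong d) = sucN-cong (repl-⊢ cp d)
  repl-⊢ cp (recN-cong {C = C} {t = t} a b c d) =
    conv-eq≡ (sym (repl-[]₀ C t))
      (recN-cong (repl-⊢ cp a)
         (conv-eq≡ (repl-[]₀ C zeroN) (repl-⊢ cp b))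
         (conv-eq≡ (repl-stepTy C) (repl-⊢ cp c))
         (repl-⊢ cp d))
  repl-⊢ cp (Π-β {B = B} {t = t} {u = u} a b c) =
    conv-eq≡ (sym (repl-[]₀ B u))
      (tmEq≡ refl (sym (repl-[]₀ t u)) (Π-β (repl-⊢ cp a) (repl-⊢ cp b) (repl-⊢ cp c)))
  repl-⊢ cp (Π-η {t = t} {t' = t'} a b c d) =
    Π-η (repl-⊢ cp a)
      (repl-⊢ cp b)
      (repl-⊢ cp c)
      (tmEq≡ (cong (λ X → app X (var fz)) (repl-wk t))
         (cong (λ X → app X (var fz)) (repl-wk t'))
         (repl-⊢ cp d))
  repl-⊢ cp (Σ-β₁ {B = B} {t = t} a b c d) =
    Σ-β₁ (repl-⊢ cp a) (repl-⊢ cp b) (repl-⊢ cp c) (conv≡ (repl-[]₀ B t) (repl-⊢ cp d))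
  repl-⊢ cp (Σ-β₂ {B = B} {t = t} a b c d) =
    conv-eq≡ (sym (repl-[]₀ B t))
      (Σ-β₂ (repl-⊢ cp a) (repl-⊢ cp b) (repl-⊢ cp c) (conv≡ (repl-[]₀ B t) (repl-⊢ cp d)))
  repl-⊢ cp (Σ-η {B = B} {t = t} a b c d) =
    Σ-η (repl-⊢ cp a) (repl-⊢ cp b) (repl-⊢ cp c) (conv-eq≡ (repl-[]₀ B (fst t)) (repl-⊢ cp d))
  repl-⊢ cp (rec₁-β {C = C} a b) =
    conv-eq≡ (sym (repl-[]₀ C ⋆)) (rec₁-β (repl-⊢ cp a) (conv≡ (repl-[]₀ C ⋆) (repl-⊢ cp b)))
  repl-⊢ cp (rec₂-β₀ {C = C} a b c) =
    conv-eq≡ (sym (repl-[]₀ C zero₂))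
      (rec₂-β₀ (repl-⊢ cp a)
         (conv≡ (repl-[]₀ C zero₂) (repl-⊢ cp b))
         (conv≡ (repl-[]₀ C one₂) (repl-⊢ cp c)))
  repl-⊢ cp (rec₂-β₁ {C = C} a b c) =
    conv-eq≡ (sym (repl-[]₀ C one₂))
      (rec₂-β₁ (repl-⊢ cp a)
         (conv≡ (repl-[]₀ C zero₂) (repl-⊢ cp b))
         (conv≡ (repl-[]₀ C one₂) (repl-⊢ cp c)))
  repl-⊢ cp (recN-β₀ {C = C} a b c) =
    conv-eq≡ (sym (repl-[]₀ C zeroN))
      (recN-β₀ (repl-⊢ cp a)
         (conv≡ (repl-[]₀ C zeroN) (repl-⊢ cp b))
         (conv≡ (repl-stepTy C) (repl-⊢ cp c)))
  repl-⊢ cp (recN-βS {C = C} {z = z} {s = s} {t = t} a b c d) =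
    conv-eq≡ (sym (repl-[]₀ C (sucN t)))
      (tmEq≡ refl (sym (repl-[,]₁ s t (recN C z s t)))
         (recN-βS (repl-⊢ cp a)
            (conv≡ (repl-[]₀ C zeroN) (repl-⊢ cp b))
            (conv≡ (repl-stepTy C) (repl-⊢ cp c))
            (repl-⊢ cp d)))

forcing-sound : (g : Tm 0) (p : Cond) → ε ⊢[ mltt ] tm g (Π N N₂) → Compatible g p →
                (nG : ℕ) → IsLeastZero g nG →
                ∀ {n} (Γ : Con n) (J : Jdg n) →
                Γ ⊢[ forc p ] J → replCon g (v nG) Γ ⊢[ mltt ] replJ g (v nG) J
forcing-sound g p ⊢g cp nG (gnG≡0 , _) Γ J =
  Translation.repl-⊢ g (v nG) ⊢g (v-tm ⊢g gnG≡0) cp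

const₀ : Tm 0
const₀ = lam zero₂

const₀-tm : ε ⊢[ mltt ] tm const₀ (Π N N₂)
const₀-tm = lam-tm (N-ty ε-wf) (zero₂-tm (∙-wf (N-ty ε-wf)))

const₀-zero : ∀ k → ε ⊢[ mltt ] tmEq (app const₀ (num k)) zero₂ N₂
const₀-zero k = Π-β (N-ty ε-wf) (zero₂-tm (∙-wf (N-ty ε-wf))) (num-tm ε-wf k)

const₀-leastZero : IsLeastZero const₀ 0
const₀-leastZero = const₀-zero 0 , λ _ ()

const₀-compatible-∅ : Compatible const₀ ∅
const₀-compatible-∅ = (λ _ _ ()) , (λ k _ → const₀-zero k)

forcing-∅-conservative : ∀ {n} (Γ : Con n) (J : Jdg n) → ConstFreeCon Γ → ConstFreeJ J →
                         Γ ⊢[ forc ∅ ] J → Γ ⊢[ mltt ] J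
forcing-∅-conservative Γ J Γ-free J-free d =
  subst₂ (λ Δ K → Δ ⊢[ mltt ] K) (replCon-constFree Γ Γ-free) (replJ-constFree J J-free)
    (forcing-sound const₀ ∅ const₀-tm const₀-compatible-∅ 0 const₀-leastZero Γ J d)
  where open Replacement const₀ (v 0)

lemma1p4 : ((g : Tm 0) (p : Cond) →
    ε ⊢[ mltt ] tm g (Π N N₂) → Compatible g p →
    (nG : ℕ) → IsLeastZero g nG →
    ∀ {n} (Γ : Con n) (J : Jdg n) →
    Γ ⊢[ forc p ] J → replCon g (v nG) Γ ⊢[ mltt ] replJ g (v nG) J)
    ×
    (∀ {n} (Γ : Con n) (J : Jdg n) → ConstFreeCon Γ → ConstFreeJ J →
    Γ ⊢[ forc ∅ ] J → Γ ⊢[ mltt ] J)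
lemma1p4 = forcing-sound , forcing-∅-conservative
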